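{- Let $G$ be a finite quasiprimitive permutation group of O'Nan–Scott type $\mathrm{SD}$ or $\mathrm{CD}$, and let $M$ be a point stabilizer. Then $M$ is a perfect code of $G$.
   Context: A permutation group is quasiprimitive if every non-trivial normal subgroup is transitive. Quasiprimitive groups fall into the eight types $\mathrm{HA},\mathrm{HS},\mathrm{HC},\mathrm{TW},\mathrm{SD},\mathrm{CD},\mathrm{AS},\mathrm{PA}$ of Praeger's O'Nan–Scott Theorem for quasiprimitive groups; in types $\mathrm{SD}$ (simple diagonal) and $\mathrm{CD}$ (compound diagonal) the socle is $N=L^k$ with $k\ge 2$ and $L$ a non-abelian characteristically simple group, and $M\cap N=\{(\ell,\dots,\ell):\ell\in L\}$ for a point stabilizer $M$. A perfect code in a simple undirected graph with vertex set $V$ is an independent subset $C\subseteq V$ such that every vertex in $V\setminus C$ is adjacent to exactly one vertex of $C$. For a group $G$ with identity $e$ and an inverse-closed $S\subseteq G\setminus\{e\}$, the Cayley graph $\mathrm{Cay}(G,S)$ has vertex set $G$ and edges $\{g,sg\}$ ($s\in S$, $g\in G$). A subset $C$ of $G$ is a perfect code of $G$ if it is a perfect code in some Cayley graph $\mathrm{Cay}(G,S)$. -}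

module Defs where

open import Level using (0ℓ)
open import Data.Nat using (ℕ; _≥_)
open import Data.Fin using (Fin)
open import Data.Product using (Σ; ∃; ∃-syntax; _×_; _,_)
open import Data.Sum using (_⊎_)
open import Relation.Nullary using (¬_)
open import Relation.Binary.PropositionalEquality using (_≡_; _≢_)
open import Function.Bundles using (_↔_)
open import Algebra.Structures using (IsGroup)

record FiniteGroup : Set₁ where
  infixl 7 _∙_
  field
    Carrier : Set
    _∙_     : Carrier → Carrier → Carrier
    e       : Carrier
    _⁻¹     : Carrier → Carrier
    isGroup : IsGroup _≡_ _∙_ e _⁻¹
    finite  : Σ ℕ λ n → Carrier ↔ Fin n

module _ (G : FiniteGroup) where
  open FiniteGroup G

  Subset : Set₁
  Subset = Carrier → Set

  _⊆_ : Subset → Subset → Set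
  A ⊆ B = ∀ x → A x → B x

  _≐_ : Subset → Subset → Set
  A ≐ B = (A ⊆ B) × (B ⊆ A)

  IsSubgroup : Subset → Set
  IsSubgroup H = H e × (∀ x y → H x → H y → H (x ∙ y)) × (∀ x → H x → H (x ⁻¹))

  IsNormalSubgroup : Subset → Set
  IsNormalSubgroup H = IsSubgroup H × (∀ g x → H x → H (g ∙ x ∙ (g ⁻¹)))

  IsTrivial : Subset → Set
  IsTrivial H = ∀ x → H x → x ≡ e

  IsMinimalNormal : Subset → Set₁
  IsMinimalNormal N =
    IsNormalSubgroup N × ¬ IsTrivial N ×
    (∀ K → IsNormalSubgroup K → K ⊆ N → IsTrivial K ⊎ (N ⊆ K))

  IsUniqueMinimalNormal : Subset → Set₁
  IsUniqueMinimalNormal N =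
    IsMinimalNormal N × (∀ K → IsMinimalNormal K → K ≐ N)

  NonAbelian : Set
  NonAbelian = ∃[ x ] ∃[ y ] (x ∙ y ≢ y ∙ x)

  IsAutomorphism : (Carrier → Carrier) → Set
  IsAutomorphism f =
    (∀ x y → f (x ∙ y) ≡ f x ∙ f y) ×
    Σ (Carrier → Carrier) λ g → ((∀ x → g (f x) ≡ x) × (∀ x → f (g x) ≡ x))

  IsCharacteristic : Subset → Set
  IsCharacteristic K =
    IsSubgroup K × (∀ f → IsAutomorphism f → ∀ x → K x → K (f x))

  CharacteristicallySimple : Set₁
  CharacteristicallySimple =
    ¬ (∀ (x : Carrier) → x ≡ e) ×
    (∀ K → IsCharacteristic K → IsTrivial K ⊎ (∀ x → K x))

  IsPerfectCodeIn : (Carrier → Carrier → Set) → Subset → Set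
  IsPerfectCodeIn Adj C =
    (∀ c c′ → C c → C c′ → ¬ Adj c c′) ×
    (∀ v → ¬ C v →
       ∃[ c ] ((C c × Adj v c) × (∀ c′ → C c′ → Adj v c′ → c′ ≡ c)))

  CayAdj : Subset → Carrier → Carrier → Set
  CayAdj S g h = ∃[ s ] (S s × h ≡ s ∙ g)

  IsConnectionSet : Subset → Set
  IsConnectionSet S = (∀ s → S s → S (s ⁻¹)) × ¬ S e

  IsPerfectCodeOfGroup : Subset → Set₁
  IsPerfectCodeOfGroup C =
    ∃[ S ] (IsConnectionSet S × IsPerfectCodeIn (CayAdj S) C)

record PermGroup (G : FiniteGroup) : Set₁ where
  open FiniteGroup G
  field
    Ω         : Set
    Ω-finite  : Σ ℕ λ n → Ω ↔ Fin n
    act       : Carrier → Ω → Ω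
    act-e     : ∀ α → act e α ≡ α
    act-∙     : ∀ g h α → act (g ∙ h) α ≡ act g (act h α)
    faithful  : ∀ g → (∀ α → act g α ≡ α) → g ≡ e

module _ {G : FiniteGroup} (P : PermGroup G) where
  open FiniteGroup G
  open PermGroup P

  Stabilizer : Ω → Subset G
  Stabilizer α g = act g α ≡ α

  IsTransitiveOn : Subset G → Set
  IsTransitiveOn H = ∀ α β → ∃[ h ] (H h × act h α ≡ β)

  IsQuasiprimitive : Set₁
  IsQuasiprimitive =
    ∀ K → IsNormalSubgroup G K → ¬ IsTrivial G K → IsTransitiveOn K

  -- O'Nan–Scott type SD or CD (quasiprimitive version, Praeger):
  -- G has a unique minimal normal subgroup N (= soc G), and there are a
  -- non-abelian characteristically simple group L, k ≥ 2 and an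
  -- isomorphism φ : L^k → N under which M ∩ N (M a point stabilizer)
  -- is the full diagonal {(ℓ,…,ℓ)}.
  IsTypeSDorCD : Set₁
  IsTypeSDorCD =
    ∃[ N ] (IsUniqueMinimalNormal G N ×
    Σ FiniteGroup λ L → let module L = FiniteGroup L in
    NonAbelian L × CharacteristicallySimple L ×
    Σ ℕ λ k → k ≥ 2 ×
    Σ ((Fin k → L.Carrier) → Carrier) λ φ →
      (∀ a b → φ (λ i → a i L.∙ b i) ≡ φ a ∙ φ b) ×
      (∀ a b → φ a ≡ φ b → ∀ i → a i ≡ b i) ×
      (∀ g → N g → ∃[ a ] (φ a ≡ g)) ×
      (∀ a → N (φ a)) ×
      ∃[ ω ] ((∀ g → (Stabilizer ω g × N g) → ∃[ ℓ ] (φ (λ _ → ℓ) ≡ g)) ×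
              (∀ ℓ → Stabilizer ω (φ (λ _ → ℓ)))))

-- If T is a complement of a subgroup H (T closed under products and inverses,
-- H ∩ T = 1 and G = TH), then in Cay(G, T ∖ {1}) the closed neighbourhood of
-- h ∈ H is Th, and these cosets partition G; so H is a perfect code.
-- For G of type SD or CD with socle N ≅ L^k and M ∩ N the diagonal, the
-- image T of {a ∈ L^k : a₁ = 1} is a complement of M: it meets the diagonal
-- trivially, and T · diag = N, so TM ⊇ NM = G because N is transitive by
-- quasiprimitivity. Other point stabilizers are conjugates of M.
module Submission where

open import Level using (0ℓ)
open import Data.Nat using (ℕ; s≤s)
open import Data.Fin using (Fin; zero)
open import Data.Product using (∃-syntax; _×_; _,_; proj₁; proj₂)
open import Relation.Nullary using (¬_)
open import Relation.Binary.PropositionalEquality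
open import Algebra.Bundles using (Group)
open import Algebra.Structures using (IsGroup)
import Algebra.Properties.Group as GroupProperties
import Algebra.Properties.Monoid as MonoidProperties
open import Defs

asGroup : FiniteGroup → Group 0ℓ 0ℓ
asGroup G = record
  { Carrier = Carrier ; _≈_ = _≡_ ; _∙_ = _∙_ ; ε = e ; _⁻¹ = _⁻¹ ; isGroup = isGroup }
  where open FiniteGroup G

module _ (G : FiniteGroup) where
  open FiniteGroup G
  open IsGroup isGroup using (assoc; identityˡ; inverseˡ; inverseʳ)
  open GroupProperties (asGroup G)
  open ≡-Reasoning

  record IsComplement (H T : Subset G) : Set where
    field
      T-∙       : ∀ x y → T x → T y → T (x ∙ y)
      T-⁻¹      : ∀ x → T x → T (x ⁻¹)
      ∩-trivial : ∀ x → H x → T x → x ≡ e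
      factorise : ∀ g → ∃[ t ] ∃[ h ] (T t × H h × g ≡ t ∙ h)

  ⁻¹≡e⇒≡e : ∀ {x} → x ⁻¹ ≡ e → x ≡ e
  ⁻¹≡e⇒≡e {x} x⁻¹≡e = ⁻¹-injective (trans x⁻¹≡e (sym ε⁻¹≈ε))

  complement⇒perfectCode : ∀ {H T} → IsSubgroup G H → IsComplement H T →
                           IsPerfectCodeOfGroup G H
  complement⇒perfectCode {H} {T} (_ , H-∙ , H-⁻¹) T-complement =
    S , (S-⁻¹ , λ (_ , e≢e) → e≢e refl) , independent , covering
    where
    open IsComplement T-complement

    S : Subset G
    S s = T s × s ≢ e

    S-⁻¹ : ∀ s → S s → S (s ⁻¹)
    S-⁻¹ s (Ts , s≢e) = T-⁻¹ s Ts , λ s⁻¹≡e → s≢e (⁻¹≡e⇒≡e s⁻¹≡e)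

    step-within-H⇒≡e : ∀ {s c c′} → H c → H c′ → T s → c′ ≡ s ∙ c → s ≡ e
    step-within-H⇒≡e {s} {c} {c′} Hc Hc′ Ts c′≡sc = ∩-trivial s Hs Ts
      where
      Hs : H s
      Hs = subst H (sym (x≈z//y s c c′ (sym c′≡sc))) (H-∙ c′ (c ⁻¹) Hc′ (H-⁻¹ c Hc))

    independent : ∀ c c′ → H c → H c′ → ¬ CayAdj G S c c′
    independent c c′ Hc Hc′ (s , (Ts , s≢e) , c′≡sc) =
      s≢e (step-within-H⇒≡e Hc Hc′ Ts c′≡sc)

    covering : ∀ v → ¬ H v →
      ∃[ c ] ((H c × CayAdj G S v c) × (∀ c′ → H c′ → CayAdj G S v c′ → c′ ≡ c))
    covering v v∉H with factorise v
    ... | t , h , Tt , Hh , v≡th =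
      h , (Hh , t ⁻¹ , (T-⁻¹ t Tt , t⁻¹≢e) , y≈x\\z t h v (sym v≡th)) , unique
      where
      t⁻¹≢e : t ⁻¹ ≢ e
      t⁻¹≢e t⁻¹≡e = v∉H (subst H (sym v≡h) Hh)
        where
        v≡h : v ≡ h
        v≡h = trans v≡th (trans (cong (_∙ h) (⁻¹≡e⇒≡e t⁻¹≡e)) (identityˡ h))

      unique : ∀ c′ → H c′ → CayAdj G S v c′ → c′ ≡ h
      unique c′ Hc′ (s , (Ts , _) , c′≡sv) = begin
        c′          ≡⟨ c′≡st∙h ⟩
        s ∙ t ∙ h   ≡⟨ cong (_∙ h) (step-within-H⇒≡e Hh Hc′ (T-∙ s t Ts Tt) c′≡st∙h) ⟩
        e ∙ h       ≡⟨ identityˡ h ⟩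
        h           ∎
        where
        c′≡st∙h : c′ ≡ s ∙ t ∙ h
        c′≡st∙h = trans c′≡sv (trans (cong (s ∙_) v≡th) (sym (assoc s t h)))

  Homomorphic : (Carrier → Carrier) → Set
  Homomorphic f = ∀ x y → f (x ∙ y) ≡ f x ∙ f y

  hom-e : ∀ {f} → Homomorphic f → f e ≡ e
  hom-e {f} f-∙ = identityˡ-unique (f e) (f e) (begin
    f e ∙ f e   ≡⟨ f-∙ e e ⟨
    f (e ∙ e)   ≡⟨ cong f (identityˡ e) ⟩
    f e         ∎)

  hom-⁻¹ : ∀ {f} → Homomorphic f → ∀ x → f (x ⁻¹) ≡ f x ⁻¹
  hom-⁻¹ {f} f-∙ x = inverseʳ-unique (f x) (f (x ⁻¹)) (begin
    f x ∙ f (x ⁻¹)   ≡⟨ f-∙ x (x ⁻¹) ⟨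
    f (x ∙ x ⁻¹)     ≡⟨ cong f (inverseʳ x) ⟩
    f e              ≡⟨ hom-e f-∙ ⟩
    e                ∎)

  module _ {f f⁻ : Carrier → Carrier} (f-∙ : Homomorphic f)
           (f⁻∘f : ∀ x → f⁻ (f x) ≡ x) (f∘f⁻ : ∀ x → f (f⁻ x) ≡ x) where

    inverse-hom : Homomorphic f⁻
    inverse-hom x y = begin
      f⁻ (x ∙ y)                  ≡⟨ cong f⁻ (cong₂ _∙_ (f∘f⁻ x) (f∘f⁻ y)) ⟨
      f⁻ (f (f⁻ x) ∙ f (f⁻ y))    ≡⟨ cong f⁻ (f-∙ (f⁻ x) (f⁻ y)) ⟨
      f⁻ (f (f⁻ x ∙ f⁻ y))        ≡⟨ f⁻∘f (f⁻ x ∙ f⁻ y) ⟩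
      f⁻ x ∙ f⁻ y                 ∎

    automorphism-complement : ∀ {H H′ T} →
      (∀ g → H′ g → H (f⁻ g)) → (∀ h → H h → H′ (f h)) →
      IsComplement H T → IsComplement H′ (λ g → T (f⁻ g))
    automorphism-complement {H} {H′} {T} H′⊆f[H] f[H]⊆H′ T-complement = record
      { T-∙       = λ x y Tx Ty → subst T (sym (inverse-hom x y)) (T-∙ _ _ Tx Ty)
      ; T-⁻¹      = λ x Tx → subst T (sym (hom-⁻¹ inverse-hom x)) (T-⁻¹ _ Tx)
      ; ∩-trivial = ∩-trivial′
      ; factorise = factorise′
      }
      where
      open IsComplement T-complement

      ∩-trivial′ : ∀ x → H′ x → T (f⁻ x) → x ≡ e
      ∩-trivial′ x H′x Tf⁻x = begin
        x          ≡⟨ f∘f⁻ x ⟨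
        f (f⁻ x)   ≡⟨ cong f (∩-trivial (f⁻ x) (H′⊆f[H] x H′x) Tf⁻x) ⟩
        f e        ≡⟨ hom-e f-∙ ⟩
        e          ∎

      factorise′ : ∀ g → ∃[ t ] ∃[ h ] (T (f⁻ t) × H′ h × g ≡ t ∙ h)
      factorise′ g with factorise (f⁻ g)
      ... | t , h , Tt , Hh , f⁻g≡th =
        f t , f h , subst T (sym (f⁻∘f t)) Tt , f[H]⊆H′ h Hh ,
        trans (sym (f∘f⁻ g)) (trans (cong f f⁻g≡th) (f-∙ t h))

  conj : Carrier → Carrier → Carrier
  conj x g = x ∙ g ∙ x ⁻¹

  conj-∙ : ∀ x g h → conj x (g ∙ h) ≡ conj x g ∙ conj x h
  conj-∙ x g h = begin
    x ∙ (g ∙ h) ∙ x ⁻¹              ≡⟨ cong (_∙ x ⁻¹) (assoc x g h) ⟨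
    x ∙ g ∙ h ∙ x ⁻¹                ≡⟨ assoc (x ∙ g) h (x ⁻¹) ⟩
    x ∙ g ∙ (h ∙ x ⁻¹)              ≡⟨ insertᶜ (inverseˡ x) (x ∙ g) (h ∙ x ⁻¹) ⟩
    x ∙ g ∙ x ⁻¹ ∙ (x ∙ (h ∙ x ⁻¹)) ≡⟨ cong (conj x g ∙_) (assoc x h (x ⁻¹)) ⟨
    conj x g ∙ conj x h             ∎
    where open MonoidProperties (Group.monoid (asGroup G)) using (insertᶜ)

  conj⁻¹∘conj : ∀ x g → conj (x ⁻¹) (conj x g) ≡ g
  conj⁻¹∘conj x g = begin
    x ⁻¹ ∙ (x ∙ g ∙ x ⁻¹) ∙ x ⁻¹ ⁻¹   ≡⟨ cong (x ⁻¹ ∙ (x ∙ g ∙ x ⁻¹) ∙_) (⁻¹-involutive x) ⟩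
    x ⁻¹ ∙ (x ∙ g ∙ x ⁻¹) ∙ x         ≡⟨ cong (_∙ x) (assoc (x ⁻¹) (x ∙ g) (x ⁻¹)) ⟨
    x ⁻¹ ∙ (x ∙ g) ∙ x ⁻¹ ∙ x         ≡⟨ cong (λ y → y ∙ x ⁻¹ ∙ x) (\\-leftDividesʳ x g) ⟩
    g ∙ x ⁻¹ ∙ x                      ≡⟨ //-rightDividesˡ x g ⟩
    g                                 ∎

  conj∘conj⁻¹ : ∀ x g → conj x (conj (x ⁻¹) g) ≡ g
  conj∘conj⁻¹ x g =
    subst (λ y → conj y (conj (x ⁻¹) g) ≡ g) (⁻¹-involutive x) (conj⁻¹∘conj (x ⁻¹) g)

module _ {G : FiniteGroup} (P : PermGroup G) where
  open FiniteGroup G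
  open PermGroup P
  open IsGroup isGroup using (inverseˡ)
  open ≡-Reasoning

  act-⁻¹ : ∀ {x α β} → act x α ≡ β → act (x ⁻¹) β ≡ α
  act-⁻¹ {x} {α} {β} xα≡β = begin
    act (x ⁻¹) β           ≡⟨ cong (act (x ⁻¹)) xα≡β ⟨
    act (x ⁻¹) (act x α)   ≡⟨ act-∙ (x ⁻¹) x α ⟨
    act (x ⁻¹ ∙ x) α       ≡⟨ cong (λ y → act y α) (inverseˡ x) ⟩
    act e α                ≡⟨ act-e α ⟩
    α                      ∎

  stabilizer-isSubgroup : ∀ α → IsSubgroup G (Stabilizer P α)
  stabilizer-isSubgroup α =
    act-e α ,
    (λ x y xα≡α yα≡α → trans (act-∙ x y α) (trans (cong (act x) yα≡α) xα≡α)) ,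
    (λ x xα≡α → act-⁻¹ xα≡α)

  stabilizer-conj : ∀ {x α β g} → act x α ≡ β →
                    Stabilizer P α g → Stabilizer P β (conj G x g)
  stabilizer-conj {x} {α} {β} {g} xα≡β gα≡α = begin
    act (x ∙ g ∙ x ⁻¹) β         ≡⟨ act-∙ (x ∙ g) (x ⁻¹) β ⟩
    act (x ∙ g) (act (x ⁻¹) β)   ≡⟨ cong (act (x ∙ g)) (act-⁻¹ xα≡β) ⟩
    act (x ∙ g) α                ≡⟨ act-∙ x g α ⟩
    act x (act g α)              ≡⟨ cong (act x) gα≡α ⟩
    act x α                      ≡⟨ xα≡β ⟩
    β                            ∎

  transitive-factorise : ∀ {K} → IsTransitiveOn P K →
                         ∀ α g → ∃[ n ] (K n × Stabilizer P α (n ⁻¹ ∙ g))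
  transitive-factorise K-transitive α g with K-transitive α (act g α)
  ... | n , Kn , nα≡gα = n , Kn , trans (act-∙ (n ⁻¹) g α) (act-⁻¹ nα≡gα)

  stabilizer-complement-conj : ∀ {x α β T} → act x α ≡ β →
    IsComplement G (Stabilizer P α) T →
    IsComplement G (Stabilizer P β) (λ g → T (conj G (x ⁻¹) g))
  stabilizer-complement-conj {x} xα≡β =
    automorphism-complement G (conj-∙ G x) (conj⁻¹∘conj G x) (conj∘conj⁻¹ G x)
      (λ g → stabilizer-conj (act-⁻¹ xα≡β))
      (λ h → stabilizer-conj xα≡β)

module Diagonal
  {G : FiniteGroup} (P : PermGroup G) {N : Subset G}
  (L : FiniteGroup) {k : ℕ} (z : Fin k)
  (φ : (Fin k → FiniteGroup.Carrier L) → FiniteGroup.Carrier G)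
  (φ-∙ : ∀ a b → φ (λ i → FiniteGroup._∙_ L (a i) (b i)) ≡ FiniteGroup._∙_ G (φ a) (φ b))
  (φ-injective : ∀ a b → φ a ≡ φ b → ∀ i → a i ≡ b i)
  (φ-onto : ∀ g → N g → ∃[ a ] (φ a ≡ g))
  (φ-into : ∀ a → N (φ a))
  (N-⁻¹ : ∀ g → N g → N (FiniteGroup._⁻¹ G g))
  (ω : PermGroup.Ω P)
  (stabilizer∩N⊆diagonal : ∀ g → Stabilizer P ω g × N g → ∃[ ℓ ] (φ (λ _ → ℓ) ≡ g))
  (diagonal⊆stabilizer : ∀ ℓ → Stabilizer P ω (φ (λ _ → ℓ)))
  (N-transitive : IsTransitiveOn P N)
  where

  open FiniteGroup G
  open IsGroup isGroup using (identityˡ; inverseʳ)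
  open GroupProperties (asGroup G)
  module L where
    open FiniteGroup L public
    open IsGroup (FiniteGroup.isGroup L) public using (identityˡ; inverseʳ)
    open GroupProperties (asGroup L) public using (identityʳ-unique)
  open ≡-Reasoning

  φ-kernel : ∀ a → φ a ≡ e → ∀ i → a i ≡ L.e
  φ-kernel a φa≡e i = L.identityʳ-unique (a i) (a i) (φ-injective _ a φ[a²]≡φa i)
    where
    φ[a²]≡φa : φ (λ i → a i L.∙ a i) ≡ φ a
    φ[a²]≡φa = begin
      φ (λ i → a i L.∙ a i)   ≡⟨ φ-∙ a a ⟩
      φ a ∙ φ a               ≡⟨ cong₂ _∙_ φa≡e φa≡e ⟩
      e ∙ e                   ≡⟨ identityˡ e ⟩
      e                       ≡⟨ φa≡e ⟨
      φ a                     ∎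

  φ-diagonal-e : φ (λ _ → L.e) ≡ e
  φ-diagonal-e = identityˡ-unique (φ ε̂) (φ ε̂)
    (trans (sym (φ-∙ ε̂ ε̂)) (cong (λ ℓ → φ (λ _ → ℓ)) (L.identityˡ L.e)))
    where
    ε̂ : Fin k → L.Carrier
    ε̂ _ = L.e

  CoordinateKernel : Subset G
  CoordinateKernel g = ∃[ a ] (a z ≡ L.e × φ a ≡ g)

  coordinateKernel-complement : IsComplement G (Stabilizer P ω) CoordinateKernel
  coordinateKernel-complement = record
    { T-∙       = λ x y (a , az≡e , φa≡x) (b , bz≡e , φb≡y) →
                    (λ i → a i L.∙ b i) ,
                    trans (cong₂ L._∙_ az≡e bz≡e) (L.identityˡ L.e) ,
                    trans (φ-∙ a b) (cong₂ _∙_ φa≡x φb≡y)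
    ; T-⁻¹      = T-⁻¹
    ; ∩-trivial = ∩-trivial
    ; factorise = factorise
    }
    where
    open MonoidProperties (Group.monoid (asGroup G)) using (cancelᶜ)
    M-∙ : ∀ x y → Stabilizer P ω x → Stabilizer P ω y → Stabilizer P ω (x ∙ y)
    M-∙ = proj₁ (proj₂ (stabilizer-isSubgroup P ω))

    M-⁻¹ : ∀ x → Stabilizer P ω x → Stabilizer P ω (x ⁻¹)
    M-⁻¹ = proj₂ (proj₂ (stabilizer-isSubgroup P ω))

    T-⁻¹ : ∀ x → CoordinateKernel x → CoordinateKernel (x ⁻¹)
    T-⁻¹ x (b , bz≡e , φb≡x) with φ-onto (x ⁻¹) (N-⁻¹ x (subst N φb≡x (φ-into b)))
    ... | c , φc≡x⁻¹ = c , cz≡e , φc≡x⁻¹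
      where
      φ[bc]≡e : φ (λ i → b i L.∙ c i) ≡ e
      φ[bc]≡e = trans (φ-∙ b c) (trans (cong₂ _∙_ φb≡x φc≡x⁻¹) (inverseʳ x))

      cz≡e : c z ≡ L.e
      cz≡e = begin
        c z           ≡⟨ L.identityˡ (c z) ⟨
        L.e L.∙ c z   ≡⟨ cong (L._∙ c z) bz≡e ⟨
        b z L.∙ c z   ≡⟨ φ-kernel _ φ[bc]≡e z ⟩
        L.e           ∎

    ∩-trivial : ∀ x → Stabilizer P ω x → CoordinateKernel x → x ≡ e
    ∩-trivial x xω≡ω (b , bz≡e , φb≡x)
      with stabilizer∩N⊆diagonal x (xω≡ω , subst N φb≡x (φ-into b))
    ... | ℓ , φℓ≡x = begin
      x                ≡⟨ φℓ≡x ⟨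
      φ (λ _ → ℓ)      ≡⟨ cong (λ ℓ′ → φ (λ _ → ℓ′)) ℓ≡e ⟩
      φ (λ _ → L.e)    ≡⟨ φ-diagonal-e ⟩
      e                ∎
      where
      ℓ≡e : ℓ ≡ L.e
      ℓ≡e = trans (φ-injective _ _ (trans φℓ≡x (sym φb≡x)) z) bz≡e

    factorise : ∀ v → ∃[ t ] ∃[ h ] (CoordinateKernel t × Stabilizer P ω h × v ≡ t ∙ h)
    factorise v with transitive-factorise P N-transitive ω v
    ... | n , Nn , n⁻¹v∈M with φ-onto n Nn
    ... | a , φa≡n =
      n ∙ δ , δ ⁻¹ ∙ (n ⁻¹ ∙ v) ,
      ((λ i → a i L.∙ a z L.⁻¹) , L.inverseʳ (a z) , trans (φ-∙ a _) (cong (_∙ δ) φa≡n)) ,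
      M-∙ _ _ (M-⁻¹ δ (diagonal⊆stabilizer (a z L.⁻¹))) n⁻¹v∈M ,
      sym (trans (cancelᶜ (inverseʳ δ) n (n ⁻¹ ∙ v)) (\\-leftDividesˡ n v))
      where
      δ : Carrier
      δ = φ (λ _ → a z L.⁻¹)

lemma5p3 : (G : FiniteGroup) (P : PermGroup G) →
    IsQuasiprimitive P → IsTypeSDorCD P →
    (ω : PermGroup.Ω P) → IsPerfectCodeOfGroup G (Stabilizer P ω)
lemma5p3 G P quasiprimitive
  (N , ((((N-subgroup , N-normal) , N-nontrivial , _) , _) , L , _ , _ ,
   _ , s≤s _ , φ , φ-∙ , φ-injective , φ-onto , φ-into ,
   ω₀ , stabilizer∩N⊆diagonal , diagonal⊆stabilizer)) ω
  with quasiprimitive N (N-subgroup , N-normal) N-nontrivial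
... | N-transitive with N-transitive ω₀ ω
... | x , _ , xω₀≡ω =
  complement⇒perfectCode G (stabilizer-isSubgroup P ω)
    (stabilizer-complement-conj P xω₀≡ω coordinateKernel-complement)
  where
  open Diagonal P L zero φ φ-∙ φ-injective φ-onto φ-into (proj₂ (proj₂ N-subgroup))
    ω₀ stabilizer∩N⊆diagonal diagonal⊆stabilizer N-transitive
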